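{- Let $G$ be a graph, let $x$ be a non-isolated vertex of $G$, and let $B$ be any block of $G$ containing $x$. Then there is an edge $xy\in E(B)$ such that $c(B,xy)=c(G,xy)\le 1$.
   Context: All graphs are simple and finite. For a graph $H$ and $S\subseteq V(H)$, a nontrivial $S$-bridge of $H$ is a component of $H-S$ together with all edges joining it to $S$. For two vertices $u,v$ of $H$, $c(H,uv)$ denotes the number of nontrivial $\{u,v\}$-bridges of $H$ that contain both $u$ and $v$. A block is a connected graph with no cutvertex; a block of $G$ is a maximal connected subgraph of $G$ that is a block. -}

module Defs where

open import Data.Nat using (ℕ)
open import Data.Fin using (Fin; _≟_)
open import Data.Bool using (Bool; true; false; _∨_)
open import Data.List using (List; length)
open import Data.List.Membership.Propositional using (_∈_)
open import Data.Product using (Σ; _×_; ∃; _,_)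
open import Relation.Nullary using (¬_)
open import Relation.Nullary.Decidable using (⌊_⌋)
open import Relation.Binary.PropositionalEquality using (_≡_; _≢_)

-- A finite simple graph whose vertex set is a subset of Fin n.
-- V v : membership of v in the vertex set; E u v : adjacency.
record Graph (n : ℕ) : Set where
  field
    V      : Fin n → Bool
    E      : Fin n → Fin n → Bool
    sym    : ∀ u v → E u v ≡ E v u
    irrefl : ∀ v → E v v ≡ false
    closed : ∀ u v → E u v ≡ true → V u ≡ true
open Graph public

_⊑_ : ∀ {n} → Graph n → Graph n → Set
H ⊑ G = (∀ v → V H v ≡ true → V G v ≡ true)
      × (∀ u v → E H u v ≡ true → E G u v ≡ true)

-- Walks in H - S, where S (given by a Boolean mask) is a set of deleted vertices.
data Walk {n} (H : Graph n) (S : Fin n → Bool) : Fin n → Fin n → Set where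
  nil  : ∀ {a} → V H a ≡ true → S a ≡ false → Walk H S a a
  cons : ∀ {a b c} → V H a ≡ true → S a ≡ false → E H a b ≡ true
       → Walk H S b c → Walk H S a c

noDel : ∀ {n} → Fin n → Bool
noDel _ = false

del1 : ∀ {n} → Fin n → Fin n → Bool
del1 v w = ⌊ w ≟ v ⌋

del2 : ∀ {n} → Fin n → Fin n → Fin n → Bool
del2 u v w = ⌊ w ≟ u ⌋ ∨ ⌊ w ≟ v ⌋

Connected : ∀ {n} → Graph n → Set
Connected H = (∃ λ v → V H v ≡ true)
            × (∀ a b → V H a ≡ true → V H b ≡ true → Walk H noDel a b)

Cutvertex : ∀ {n} → Graph n → Fin n → Set
Cutvertex H v = V H v ≡ true × ∃ λ a → ∃ λ b →
  V H a ≡ true × V H b ≡ true × a ≢ v × b ≢ v × ¬ Walk H (del1 v) a b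

IsBlock : ∀ {n} → Graph n → Set
IsBlock H = Connected H × (∀ v → ¬ Cutvertex H v)

BlockOf : ∀ {n} → Graph n → Graph n → Set
BlockOf B G = B ⊑ G × IsBlock B
            × (∀ H → B ⊑ H → H ⊑ G → IsBlock H → H ⊑ B)

-- The component of H - {u,v} containing w, together with its edges to {u,v}
-- (the nontrivial {u,v}-bridge determined by w), contains both u and v.
BridgeHasBoth : ∀ {n} → Graph n → Fin n → Fin n → Fin n → Set
BridgeHasBoth H u v w =
  V H w ≡ true × del2 u v w ≡ false
  × (∃ λ a → Walk H (del2 u v) w a × E H a u ≡ true)
  × (∃ λ b → Walk H (del2 u v) w b × E H b v ≡ true)

-- c(H,uv) = k : there are exactly k nontrivial {u,v}-bridges of H containing
-- both u and v, witnessed by a list of k representatives, one per such bridge.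
CEq : ∀ {n} → Graph n → Fin n → Fin n → ℕ → Set
CEq H u v k = Σ (List _) λ ws →
    length ws ≡ k
  × (∀ w → w ∈ ws → BridgeHasBoth H u v w)
  × (∀ w w' → w ∈ ws → w' ∈ ws → Walk H (del2 u v) w w' → w ≡ w')
  × (∀ z → BridgeHasBoth H u v z → ∃ λ w → w ∈ ws × Walk H (del2 u v) z w)

module Submission where

open import Defs
open import Data.Nat using (ℕ; _≤_)
open import Data.Fin using (Fin)
open import Data.Bool using (true)
open import Data.Product using (∃; _×_)
open import Relation.Binary.PropositionalEquality using (_≡_)

open import Data.Nat using (zero; suc; _<_; _+_; z≤n; s≤s)
open import Data.Nat.Properties
  using (≤-trans; ≤-reflexive; <-≤-trans; <⇒≤; <⇒≱; +-suc; +-identityʳ; +-monoˡ-≤; m≤n+m)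
open import Data.Fin using (_≟_)
open import Data.Fin.Properties using (any?)
import Data.Fin.Subset as Subset
open import Data.Fin.Subset.Properties using (∣p∣≤n; p⊂q⇒∣p∣<∣q∣)
open import Data.Vec using (tabulate)
open import Data.Vec.Properties using (lookup∘tabulate; []=⇒lookup; lookup⇒[]=)
open import Data.Bool using (Bool; false; _∨_; _∧_)
open import Data.Bool.Properties using (∨-zeroʳ; ∨-conicalˡ; ∨-conicalʳ; ∧-comm) renaming (_≟_ to _≟ᵇ_)
open import Data.Product using (Σ; _,_; proj₁; proj₂)
open import Data.Sum using (_⊎_; inj₁; inj₂; [_,_])
open import Data.Empty using (⊥-elim)
open import Data.Unit using (⊤; tt)
open import Data.List using ([]; _∷_)
open import Data.List.Relation.Unary.Any using (here)
open import Relation.Nullary using (¬_; Dec; yes; no)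
open import Relation.Nullary.Decidable using (⌊_⌋; _×-dec_; ¬?)
open import Relation.Binary.PropositionalEquality using (_≢_; ≢-sym; refl; trans) renaming (sym to ≡-sym)

-- Proof. (1) x has a neighbour in B: otherwise B = {x}, and B plus an edge
-- xz of G would be a larger block. (2) Some neighbour y of x in B leaves
-- B - {x,y} connected: if c cannot reach d in B - {x,y}, a walk from d to x
-- in B - y (B has no cutvertex) first meets x at a neighbour y′, and the
-- component of y in B - {x,y′} strictly contains that of c in B - {x,y};
-- component sizes are bounded by n, so iterating this terminates.
-- (3) Every {x,y}-bridge of G containing x and y meets B - {x,y}: otherwise
-- it contains a path outside B from a neighbour of x to a neighbour of y,
-- and adding this ear to B gives a larger block. Hence c(B,xy) = c(G,xy) = 0
-- if B = {x,y}, and otherwise both are 1: every such bridge, of B or of G,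
-- is the one through the connected graph B - {x,y}.

∨-true : ∀ a {b} → a ∨ b ≡ true → a ≡ true ⊎ b ≡ true
∨-true true  _ = inj₁ refl
∨-true false p = inj₂ p

∨-introˡ : ∀ {a} b → a ≡ true → a ∨ b ≡ true
∨-introˡ b refl = refl

∨-introʳ : ∀ a {b} → b ≡ true → a ∨ b ≡ true
∨-introʳ a refl = ∨-zeroʳ a

∧-true : ∀ a {b} → a ∧ b ≡ true → a ≡ true × b ≡ true
∧-true true {true} _ = refl , refl

∧-intro : ∀ {a b} → a ≡ true → b ≡ true → a ∧ b ≡ true
∧-intro refl refl = refl

true≢false : true ≢ false
true≢false ()

≟-sound : ∀ {n} {u v : Fin n} → ⌊ u ≟ v ⌋ ≡ true → u ≡ v
≟-sound {u = u} {v} p with u ≟ v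
... | yes u≡v = u≡v

≟-refl : ∀ {n} (u : Fin n) → ⌊ u ≟ u ⌋ ≡ true
≟-refl u with u ≟ u
... | yes _  = refl
... | no u≢u = ⊥-elim (u≢u refl)

≟-apart : ∀ {n} {u v : Fin n} → u ≢ v → ⌊ u ≟ v ⌋ ≡ false
≟-apart {u = u} {v} u≢v with u ≟ v
... | yes u≡v = ⊥-elim (u≢v u≡v)
... | no _    = refl

≟-apart⁻ : ∀ {n} {u v : Fin n} → ⌊ u ≟ v ⌋ ≡ false → u ≢ v
≟-apart⁻ {u = u} {v} p u≡v with u ≟ v
... | no u≢v = u≢v u≡v

del1-keeps : ∀ {n} {v w : Fin n} → w ≢ v → del1 v w ≡ false
del1-keeps = ≟-apart

del1-keeps⁻ : ∀ {n} {v w : Fin n} → del1 v w ≡ false → w ≢ v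
del1-keeps⁻ = ≟-apart⁻

del2-keeps : ∀ {n} {u v w : Fin n} → w ≢ u → w ≢ v → del2 u v w ≡ false
del2-keeps w≢u w≢v rewrite ≟-apart w≢u | ≟-apart w≢v = refl

del2-keeps⁻ : ∀ {n} {u v w : Fin n} → del2 u v w ≡ false → w ≢ u × w ≢ v
del2-keeps⁻ p = ≟-apart⁻ (∨-conicalˡ _ _ p) , ≟-apart⁻ (∨-conicalʳ _ _ p)

del2-deletes : ∀ {n} (u v : Fin n) → del2 u v v ≡ true
del2-deletes u v = ∨-introʳ ⌊ v ≟ u ⌋ (≟-refl v)

del2-swap : ∀ {n} {u v w : Fin n} → del2 u v w ≡ false → del2 v u w ≡ false
del2-swap {u = u} {v} {w} p =
  let (w≢u , w≢v) = del2-keeps⁻ {u = u} {v} {w} p in del2-keeps w≢v w≢u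

-- The number of elements of Fin n satisfying a Boolean predicate: the size
-- of the subset tabulate f, so that Data.Fin.Subset supplies its properties.
count : ∀ {n} → (Fin n → Bool) → ℕ
count f = Subset.∣ tabulate f ∣

_⊆ᵇ_ : ∀ {n} → (Fin n → Bool) → (Fin n → Bool) → Set
f ⊆ᵇ g = ∀ i → f i ≡ true → g i ≡ true

∈-tabulate : ∀ {n} {f : Fin n → Bool} {i} → f i ≡ true → i Subset.∈ tabulate f
∈-tabulate {f = f} {i} fi = lookup⇒[]= i (tabulate f) (trans (lookup∘tabulate f i) fi)

∈-tabulate⁻ : ∀ {n} {f : Fin n → Bool} {i} → i Subset.∈ tabulate f → f i ≡ true
∈-tabulate⁻ {f = f} {i} i∈f = trans (≡-sym (lookup∘tabulate f i)) ([]=⇒lookup i∈f)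

count-strict : ∀ {n} {f g : Fin n → Bool} {a} → f ⊆ᵇ g → f a ≡ false → g a ≡ true
             → count f < count g
count-strict {f = f} {g} {a} f⊆g fa ga = p⊂q⇒∣p∣<∣q∣
  ( (λ i∈f → ∈-tabulate {f = g} (f⊆g _ (∈-tabulate⁻ {f = f} i∈f)))
  , a , ∈-tabulate {f = g} ga , λ a∈f → true≢false (trans (≡-sym (∈-tabulate⁻ {f = f} a∈f)) fa))

count-< : ∀ {n} {f : Fin n → Bool} {a} → f a ≡ false → count f < n
count-< {n} {f} fa =
  <-≤-trans (count-strict {f = f} {g = λ _ → true} (λ _ _ → refl) fa refl) (∣p∣≤n (tabulate {n = n} (λ _ → true)))

count-≤ : ∀ {n} {f : Fin n → Bool} → count f ≤ n
count-≤ {f = f} = ∣p∣≤n (tabulate f)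

module Walks {n} (H : Graph n) where

  private variable
    S S′ : Fin n → Bool
    a b c t u : Fin n

  start : Walk H S a b → V H a ≡ true × S a ≡ false
  start (nil p q)      = p , q
  start (cons p q _ _) = p , q

  finish : Walk H S a b → V H b ≡ true × S b ≡ false
  finish (nil p q)      = p , q
  finish (cons _ _ _ w) = finish w

  infixr 5 _++_
  _++_ : Walk H S a b → Walk H S b c → Walk H S a c
  nil _ _      ++ w′ = w′
  cons p q e w ++ w′ = cons p q e (w ++ w′)

  edge : V H a ≡ true → S a ≡ false → E H a b ≡ true → S b ≡ false → Walk H S a b
  edge {b = b} p q e s = cons p q e (nil (closed H b _ (trans (Graph.sym H b _) e)) s)

  snoc : Walk H S a b → E H b c ≡ true → S c ≡ false → Walk H S a c
  snoc w e s = w ++ edge (proj₁ (finish w)) (proj₂ (finish w)) e s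

  reverse : Walk H S a b → Walk H S b a
  reverse (nil p q)               = nil p q
  reverse {a = a} (cons p q e w) = snoc (reverse w) (trans (Graph.sym H _ a) e) q

  weaken : (∀ u → S u ≡ false → S′ u ≡ false) → Walk H S a b → Walk H S′ a b
  weaken h (nil p q)      = nil p (h _ q)
  weaken h (cons p q e w) = cons p (h _ q) e (weaken h w)

  confine : (∀ u → Walk H S a u → S′ u ≡ false) → Walk H S a b → Walk H S′ a b
  confine h (nil p q)      = nil p (h _ (nil p q))
  confine h (cons p q e w) = cons p (h _ (nil p q)) e (confine (λ u w′ → h u (cons p q e w′)) w)

  firstHit : Walk H (del1 u) c t → c ≢ t → ∃ λ a → Walk H (del2 t u) c a × E H a t ≡ true
  firstHit (nil p q) c≢t = ⊥-elim (c≢t refl)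
  firstHit {t = t} (cons {a = c} {b = b} p q e w) c≢t with b ≟ t
  ... | yes refl = c , nil p (del2-keeps c≢t (del1-keeps⁻ q)) , e
  ... | no b≢t with firstHit w b≢t
  ...   | a , w′ , e′ = a , cons p (del2-keeps c≢t (del1-keeps⁻ q)) e w′ , e′

  length : Walk H S a b → ℕ
  length (nil _ _)      = 0
  length (cons _ _ _ w) = suc (length w)

  visits : Walk H S a b → Fin n → Bool
  visits (nil {a} _ _)      u = ⌊ u ≟ a ⌋
  visits (cons {a} _ _ _ w) u = ⌊ u ≟ a ⌋ ∨ visits w u

  IsPath : Walk H S a b → Set
  IsPath (nil _ _)          = ⊤
  IsPath (cons {a} _ _ _ w) = visits w a ≡ false × IsPath w

  visits-start : (w : Walk H S a b) → visits w a ≡ true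
  visits-start {a = a} (nil _ _)      = ≟-refl a
  visits-start {a = a} (cons _ _ _ w) = ∨-introˡ (visits w a) (≟-refl a)

  visits-finish : (w : Walk H S a b) → visits w b ≡ true
  visits-finish {b = b} (nil _ _)   = ≟-refl b
  visits-finish {b = b} (cons {a} _ _ _ w) = ∨-introʳ ⌊ b ≟ a ⌋ (visits-finish w)

  visits-kept : (w : Walk H S a b) → visits w u ≡ true → V H u ≡ true × S u ≡ false
  visits-kept (nil p q) o with refl ← ≟-sound o = p , q
  visits-kept {u = u} (cons {a} p q _ w) o with ∨-true ⌊ u ≟ a ⌋ o
  ... | inj₁ u≡a with refl ← ≟-sound u≡a = p , q
  ... | inj₂ o′ = visits-kept w o′

  suffix : (w : Walk H S a b) → visits w c ≡ true → Σ (Walk H S c b) λ w′ → IsPath w → IsPath w′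
  suffix (nil p q) o with refl ← ≟-sound o = nil p q , λ path → path
  suffix {c = c} (cons {a} p q e w) o with c ≟ a
  ... | yes refl = cons p q e w , λ path → path
  ... | no _ with suffix w o
  ...   | w′ , keep = w′ , λ path → keep (proj₂ path)

  toPath : Walk H S a b → Σ (Walk H S a b) IsPath
  toPath (nil p q) = nil p q , tt
  toPath {a = a} (cons p q e w) with toPath w
  ... | w′ , path with visits w′ a in revisit
  ...   | true  = let (w″ , keep) = suffix w′ revisit in w″ , keep path
  ...   | false = cons p q e w′ , revisit , path

  path-visits : (w : Walk H S a b) → IsPath w → suc (length w) ≤ count (visits w)
  path-visits {a = a} w@(nil _ _) _ =
    ≤-trans (s≤s z≤n) (count-strict {f = λ _ → false} {g = visits w} (λ _ ()) refl (≟-refl a))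
  path-visits {a = a} (cons p q e w) (fresh , path) =
    <-≤-trans (s≤s (path-visits w path))
              (count-strict {f = visits w} {g = visits (cons p q e w)}
                            (λ _ o → ∨-introʳ _ o) fresh (visits-start (cons p q e w)))

  path-short : (w : Walk H S a b) → IsPath w → length w < n
  path-short w path = ≤-trans (path-visits w path) (count-≤ {f = visits w})

  Short : (Fin n → Bool) → ℕ → Fin n → Fin n → Set
  Short S k a b = Σ (Walk H S a b) λ w → length w ≤ k

  short? : ∀ S k a b → Dec (Short S k a b)
  short? S k a b with V H a ≟ᵇ true | S a ≟ᵇ false
  ... | no a∉H | _      = no λ (w , _) → a∉H (proj₁ (start w))
  ... | yes _  | no a∈S = no λ (w , _) → a∈S (proj₂ (start w))
  ... | yes p  | yes q with a ≟ b
  ...   | yes refl = yes (nil p q , z≤n)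
  short? S zero a b | yes p | yes q | no a≢b =
    no λ { (nil _ _ , _) → a≢b refl ; (cons _ _ _ _ , ()) }
  short? S (suc k) a b | yes p | yes q | no a≢b
    with any? (λ c → (E H a c ≟ᵇ true) ×-dec short? S k c b)
  ... | yes (c , e , w , l) = yes (cons p q e w , s≤s l)
  ... | no none = no λ { (nil _ _ , _) → a≢b refl ; (cons _ _ e w , s≤s l) → none (_ , e , w , l) }

  -- reachability in H - S is decidable: a connecting path has fewer than n edges
  reach? : ∀ S a b → Dec (Walk H S a b)
  reach? S a b with short? S n a b
  ... | yes (w , _) = yes w
  ... | no none     = no λ w → let (p , path) = toPath w in none (p , <⇒≤ (path-short p path))

  component : (Fin n → Bool) → Fin n → Fin n → Bool
  component S a b = ⌊ reach? S a b ⌋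

  component-sound : component S a b ≡ true → Walk H S a b
  component-sound {S} {a} {b} p with reach? S a b
  ... | yes w = w

  component-complete : Walk H S a b → component S a b ≡ true
  component-complete {S} {a} {b} w with reach? S a b
  ... | yes _  = refl
  ... | no ¬w = ⊥-elim (¬w w)

  component-deleted : S b ≡ true → component S a b ≡ false
  component-deleted {S} {b} {a} b∈S with reach? S a b
  ... | no _  = refl
  ... | yes w = ⊥-elim (true≢false (trans (≡-sym b∈S) (proj₂ (finish w))))

lift : ∀ {n} {H₁ H₂ : Graph n} {S a b} → H₁ ⊑ H₂ → Walk H₁ S a b → Walk H₂ S a b
lift H₁⊑H₂ (nil p q)      = nil (proj₁ H₁⊑H₂ _ p) q
lift H₁⊑H₂ (cons p q e w) = cons (proj₁ H₁⊑H₂ _ p) q (proj₂ H₁⊑H₂ _ _ e) (lift H₁⊑H₂ w)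

induced : ∀ {n} → Graph n → (Fin n → Bool) → Graph n
induced G P = record
  { V      = λ u → V G u ∧ P u
  ; E      = λ u v → E G u v ∧ (P u ∧ P v)
  ; sym    = symmetric
  ; irrefl = irreflexive
  ; closed = closure }
  where
  symmetric : ∀ u v → E G u v ∧ (P u ∧ P v) ≡ E G v u ∧ (P v ∧ P u)
  symmetric u v rewrite Graph.sym G u v | ∧-comm (P u) (P v) = refl
  irreflexive : ∀ v → E G v v ∧ (P v ∧ P v) ≡ false
  irreflexive v rewrite Graph.irrefl G v = refl
  closure : ∀ u v → E G u v ∧ (P u ∧ P v) ≡ true → V G u ∧ P u ≡ true
  closure u v e with ∧-true (E G u v) e
  ... | uv , PuPv = ∧-intro (closed G u v uv) (proj₁ (∧-true (P u) PuPv))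

induced⊑ : ∀ {n} (G : Graph n) P → induced G P ⊑ G
induced⊑ G P = (λ v p → proj₁ (∧-true (V G v) p)) , (λ u v e → proj₁ (∧-true (E G u v) e))

induced-vertex : ∀ {n} (G : Graph n) P {u} → V G u ≡ true → P u ≡ true → V (induced G P) u ≡ true
induced-vertex G P = ∧-intro

induced-edge : ∀ {n} (G : Graph n) P {u v} → E G u v ≡ true → P u ≡ true → P v ≡ true
             → E (induced G P) u v ≡ true
induced-edge G P uv Pu Pv = ∧-intro uv (∧-intro Pu Pv)

_∪_ : ∀ {n} → Graph n → Graph n → Graph n
H₁ ∪ H₂ = record
  { V      = λ u → V H₁ u ∨ V H₂ u
  ; E      = λ u v → E H₁ u v ∨ E H₂ u v
  ; sym    = symmetric
  ; irrefl = irreflexive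
  ; closed = closure }
  where
  symmetric : ∀ u v → E H₁ u v ∨ E H₂ u v ≡ E H₁ v u ∨ E H₂ v u
  symmetric u v rewrite Graph.sym H₁ u v | Graph.sym H₂ u v = refl
  irreflexive : ∀ v → E H₁ v v ∨ E H₂ v v ≡ false
  irreflexive v rewrite Graph.irrefl H₁ v | Graph.irrefl H₂ v = refl
  closure : ∀ u v → E H₁ u v ∨ E H₂ u v ≡ true → V H₁ u ∨ V H₂ u ≡ true
  closure u v e with ∨-true (E H₁ u v) e
  ... | inj₁ e₁ = ∨-introˡ (V H₂ u) (closed H₁ u v e₁)
  ... | inj₂ e₂ = ∨-introʳ (V H₁ u) (closed H₂ u v e₂)

⊑-∪ˡ : ∀ {n} (H₁ H₂ : Graph n) → H₁ ⊑ (H₁ ∪ H₂)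
⊑-∪ˡ H₁ H₂ = (λ v p → ∨-introˡ (V H₂ v) p) , (λ u v e → ∨-introˡ (E H₂ u v) e)

⊑-∪ʳ : ∀ {n} (H₁ H₂ : Graph n) → H₂ ⊑ (H₁ ∪ H₂)
⊑-∪ʳ H₁ H₂ = (λ v p → ∨-introʳ (V H₁ v) p) , (λ u v e → ∨-introʳ (E H₁ u v) e)

∪-least : ∀ {n} {H₁ H₂ G : Graph n} → H₁ ⊑ G → H₂ ⊑ G → (H₁ ∪ H₂) ⊑ G
∪-least {H₁ = H₁} (V₁ , E₁) (V₂ , E₂) =
  (λ v p → [ V₁ v , V₂ v ] (∨-true (V H₁ v) p)) , (λ u v e → [ E₁ u v , E₂ u v ] (∨-true (E H₁ u v) e))

-- In a block B, deleting any vertex v leaves the other vertices connected.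
-- (If v is in B this is the absence of cutvertices, made constructive by
-- decidability of reachability; otherwise it is connectivity of B.)
block-avoid : ∀ {n} {B : Graph n} → IsBlock B → ∀ v {u t}
            → V B u ≡ true → V B t ≡ true → u ≢ v → t ≢ v → Walk B (del1 v) u t
block-avoid {B = B} (_ , noCut) v {u} {t} uB tB u≢v t≢v with V B v in vB
... | true with Walks.reach? B (del1 v) u t
...   | yes w = w
...   | no ¬w = ⊥-elim (noCut v (vB , u , t , uB , tB , u≢v , t≢v , ¬w))
block-avoid {B = B} ((_ , connected) , _) v {u} {t} uB tB u≢v t≢v | false =
  Walks.confine B (λ w uw → del1-keeps λ { refl → true≢false (trans (≡-sym (proj₁ (Walks.finish B uw))) vB) })
                (connected u t uB tB)

block-approach : ∀ {n} {B : Graph n} → IsBlock B → ∀ {c t u}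
               → V B c ≡ true → V B t ≡ true → c ≢ t → c ≢ u → t ≢ u
               → ∃ λ a → Walk B (del2 t u) c a × E B a t ≡ true
block-approach {B = B} blk cB tB c≢t c≢u t≢u =
  Walks.firstHit B (block-avoid blk _ cB tB c≢u t≢u) c≢t

edge-block : ∀ {n} {H : Graph n} {x z} → (∀ u → V H u ≡ true → u ≡ x ⊎ u ≡ z)
           → E H x z ≡ true → IsBlock H
edge-block {H = H} {x} {z} two xz = ((x , xH) , connected) , noCut
  where
  open Walks H
  xH : V H x ≡ true
  xH = closed H x z xz
  zH : V H z ≡ true
  zH = closed H z x (trans (Graph.sym H z x) xz)
  connected : ∀ a b → V H a ≡ true → V H b ≡ true → Walk H noDel a b
  connected a b aH bH with two a aH | two b bH
  ... | inj₁ refl | inj₁ refl = nil xH refl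
  ... | inj₁ refl | inj₂ refl = edge xH refl xz refl
  ... | inj₂ refl | inj₁ refl = reverse (edge xH refl xz refl)
  ... | inj₂ refl | inj₂ refl = nil zH refl
  -- both remaining vertices differ from v, so they coincide
  noCut : ∀ v → ¬ Cutvertex H v
  noCut v (vH , a , b , aH , bH , a≢v , b≢v , ¬w) with two v vH | two a aH | two b bH
  ... | _         | inj₁ refl | inj₁ refl = ¬w (nil aH (del1-keeps a≢v))
  ... | _         | inj₂ refl | inj₂ refl = ¬w (nil aH (del1-keeps a≢v))
  ... | inj₁ refl | inj₁ refl | inj₂ refl = a≢v refl
  ... | inj₂ refl | inj₁ refl | inj₂ refl = b≢v refl
  ... | inj₁ refl | inj₂ refl | inj₁ refl = b≢v refl
  ... | inj₂ refl | inj₂ refl | inj₁ refl = a≢v refl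

module Segments {n} (G : Graph n) (P : Fin n → Bool) where
  open Walks G using (visits; IsPath; visits-start; visits-kept)
  K : Graph n
  K = induced G P
  open Walks K using (snoc)

  private variable
    S : Fin n → Bool
    s t u v : Fin n

  OnWalk : (Fin n → Set) → Walk G S s t → Set
  OnWalk Q w = ∀ {z} → visits w z ≡ true → Q z

  -- what holds on all of cons p q e w holds on w (the hypothesis is stated
  -- with visits (cons p q e w) unfolded, so p, q, e need not be inferred)
  onTail : ∀ {Q a} (w : Walk G S s t) → (∀ {z} → ⌊ z ≟ a ⌋ ∨ visits w z ≡ true → Q z) → OnWalk Q w
  onTail {a = a} w all {z} o = all (∨-introʳ ⌊ z ≟ a ⌋ o)

  inK : (w : Walk G S s t) → OnWalk (λ z → P z ≡ true) w → visits w u ≡ true → V K u ≡ true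
  inK w inP o = induced-vertex G P (proj₁ (visits-kept w o)) (inP o)

  toEnd : (w : Walk G S s t) → OnWalk (λ z → P z ≡ true) w → OnWalk (_≢ v) w
        → visits w u ≡ true → Walk K (del1 v) u t
  toEnd w@(nil _ _) inP avoid o with refl ← ≟-sound o = nil (inK w inP o) (del1-keeps (avoid o))
  toEnd {u = u} w@(cons {a = s} p q e rest) inP avoid o with u ≟ s
  ... | yes refl = cons (inK w inP atStart) (del1-keeps (avoid atStart))
                        (induced-edge G P e (inP atStart) (onTail rest inP (visits-start rest)))
                         (toEnd rest (onTail rest inP) (onTail rest avoid) (visits-start rest))
    where
    atStart : visits w u ≡ true
    atStart = visits-start w
  ... | no _     = toEnd rest (onTail rest inP) (onTail rest avoid) o

  toSomeEnd : (w : Walk G S s t) → OnWalk (λ z → P z ≡ true) w → IsPath w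
            → visits w u ≡ true → u ≢ v
            → Walk K (del1 v) u s ⊎ (visits w v ≡ true × Walk K (del1 v) u t)
  toSomeEnd w@(nil _ _) inP _ o u≢v with refl ← ≟-sound o = inj₁ (nil (inK w inP o) (del1-keeps u≢v))
  toSomeEnd {u = u} {v = v} w@(cons {a = s} {b = b} p q e rest) inP (fresh , path) o u≢v with u ≟ s
  ... | yes refl = inj₁ (nil (inK w inP (visits-start w)) (del1-keeps u≢v))
  ... | no _ with s ≟ v
  ...   | yes refl = inj₂ (visits-start w , toEnd rest (onTail rest inP) avoid o)
    where
    avoid : OnWalk (_≢ s) rest
    avoid o′ refl = true≢false (trans (≡-sym o′) fresh)
  ...   | no s≢v with toSomeEnd rest (onTail rest inP) path o u≢v
  ...     | inj₂ (onRest , r) = inj₂ (∨-introʳ ⌊ v ≟ s ⌋ onRest , r)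
  ...     | inj₁ r = inj₁ (snoc r (induced-edge G P (trans (Graph.sym G b s) e) bP sP) (del1-keeps s≢v))
    where
    sP : P s ≡ true
    sP = inP (visits-start w)
    bP : P b ≡ true
    bP = onTail rest inP (visits-start rest)

module Ear {n} {G B : Graph n} (blk : IsBlock B) {x y a₁ a₂ : Fin n}
           (xB : V B x ≡ true) (yB : V B y ≡ true) (x≢y : x ≢ y)
           (W : Walk G (V B) a₁ a₂) (path : Walks.IsPath G W)
           (a₁x : E G a₁ x ≡ true) (a₂y : E G a₂ y ≡ true) where

  open Walks G using (visits; visits-start; visits-finish; visits-kept)

  span : Fin n → Bool
  span u = visits W u ∨ (⌊ u ≟ x ⌋ ∨ ⌊ u ≟ y ⌋)

  H : Graph n
  H = B ∪ induced G span

  open Walks H using (_++_; snoc; reverse; weaken)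
  open Segments G span using (OnWalk; toEnd; toSomeEnd)

  fromB : ∀ {S a b} → Walk B S a b → Walk H S a b
  fromB = lift (⊑-∪ˡ B (induced G span))

  fromSpan : ∀ {S a b} → Walk (induced G span) S a b → Walk H S a b
  fromSpan = lift (⊑-∪ʳ B (induced G span))

  W-in-span : OnWalk (λ z → span z ≡ true) W
  W-in-span {z} o = ∨-introˡ (⌊ z ≟ x ⌋ ∨ ⌊ z ≟ y ⌋) o

  x-in-span : span x ≡ true
  x-in-span = ∨-introʳ (visits W x) (∨-introˡ ⌊ x ≟ y ⌋ (≟-refl x))

  y-in-span : span y ≡ true
  y-in-span = ∨-introʳ (visits W y) (∨-introʳ ⌊ y ≟ x ⌋ (≟-refl y))

  off-B : ∀ {u v} → V B u ≡ true → visits W v ≡ true → u ≢ v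
  off-B uB o refl = true≢false (trans (≡-sym uB) (proj₂ (visits-kept W o)))

  a₁x-H : E H a₁ x ≡ true
  a₁x-H = ∨-introʳ (E B a₁ x)
            (induced-edge G span a₁x (W-in-span (visits-start W)) x-in-span)

  a₂y-H : E H a₂ y ≡ true
  a₂y-H = ∨-introʳ (E B a₂ y)
            (induced-edge G span a₂y (W-in-span (visits-finish W)) y-in-span)

  classify : ∀ {u} → V H u ≡ true → V B u ≡ true ⊎ visits W u ≡ true
  classify {u} uH with ∨-true (V B u) uH
  ... | inj₁ uB = inj₁ uB
  ... | inj₂ uG with ∨-true (visits W u) (proj₂ (∧-true (V G u) uG))
  ...   | inj₁ onW = inj₂ onW
  ...   | inj₂ u=x∨y with ∨-true ⌊ u ≟ x ⌋ u=x∨y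
  ...     | inj₁ u=x with refl ← ≟-sound u=x = inj₁ xB
  ...     | inj₂ u=y with refl ← ≟-sound u=y = inj₁ yB

  hubY : ∀ {u} → V H u ≡ true → u ≢ x → Walk H (del1 x) u y
  hubY {u} uH u≢x with classify uH
  ... | inj₁ uB  = fromB (block-avoid blk x uB yB u≢x (≢-sym x≢y))
  ... | inj₂ onW = snoc (fromSpan (toEnd W W-in-span (λ o → ≢-sym (off-B xB o)) onW)) a₂y-H
                        (del1-keeps (≢-sym x≢y))

  -- with a vertex v ≠ x deleted, every other vertex of H still reaches x:
  -- a vertex of W runs along W to a₁, or (if v is on W, hence v ∉ B) to a₂ and y
  hubX : ∀ {u v} → V H u ≡ true → u ≢ v → v ≢ x → Walk H (del1 v) u x
  hubX {u} {v} uH u≢v v≢x with classify uH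
  ... | inj₁ uB  = fromB (block-avoid blk v uB xB u≢v (≢-sym v≢x))
  ... | inj₂ onW with toSomeEnd W W-in-span path onW u≢v
  ...   | inj₁ toA₁ = snoc (fromSpan toA₁) a₁x-H (del1-keeps (≢-sym v≢x))
  ...   | inj₂ (onV , toA₂) =
          snoc (fromSpan toA₂) a₂y-H (del1-keeps y≢v) ++ fromB (block-avoid blk v yB xB y≢v (≢-sym v≢x))
    where
    y≢v : y ≢ v
    y≢v = off-B yB onV

  xH : V H x ≡ true
  xH = ∨-introˡ (V (induced G span) x) xB

  -- H is connected: every vertex reaches y avoiding x, and y reaches x in B
  toX : ∀ {u} → V H u ≡ true → Walk H noDel u x
  toX {u} uH = via (u ≟ x)
    where
    -- (a helper rather than 'with', which would also rewrite span inside uH)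
    via : Dec (u ≡ x) → Walk H noDel u x
    via (yes refl) = nil xH refl
    via (no u≢x)   = weaken (λ _ _ → refl) (hubY uH u≢x) ++ fromB (proj₂ (proj₁ blk) y x yB xB)

  isBlock : IsBlock H
  isBlock = ((x , xH) , λ a b aH bH → toX aH ++ reverse (toX bH)) , noCut
    where
    noCut : ∀ v → ¬ Cutvertex H v
    noCut v (_ , a , b , aH , bH , a≢v , b≢v , ¬walk) with v ≟ x
    ... | yes refl = ¬walk (hubY aH a≢v ++ reverse (hubY bH b≢v))
    ... | no v≢x   = ¬walk (hubX aH a≢v v≢x ++ reverse (hubX bH b≢v v≢x))

  -- H properly extends B: it contains a₁, which lies outside B
  extends : ¬ (H ⊑ B)
  extends H⊑B = off-B (proj₁ H⊑B a₁ a₁H) a₁W refl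
    where
    a₁W : visits W a₁ ≡ true
    a₁W = visits-start W
    a₁H : V H a₁ ≡ true
    a₁H = ∨-introʳ (V B a₁) (induced-vertex G span (proj₁ (visits-kept W a₁W)) (W-in-span a₁W))

module AroundVertex {n} {B : Graph n} (blk : IsBlock B) {x : Fin n} (xB : V B x ≡ true) where

  open Walks B using (_++_; reverse; snoc; finish; confine; weaken; reach?;
                      component; component-sound; component-complete; component-deleted)

  private variable
    y c : Fin n

  Rest : Fin n → Fin n → Set
  Rest y c = V B c ≡ true × del2 x y c ≡ false

  rest? : ∀ y c → Dec (Rest y c)
  rest? y c = (V B c ≟ᵇ true) ×-dec (del2 x y c ≟ᵇ false)

  Good : Fin n → Set
  Good y = ∀ {a b} → Rest y a → Rest y b → Walk B (del2 x y) a b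

  size : Fin n → Fin n → ℕ
  size y c = count (component (del2 x y) c)

  size<n : size y c < n
  size<n {y} {c} = count-< {f = component (del2 x y) c} {a = y} (component-deleted (del2-deletes x y))

  neighbour-in-B : E B x y ≡ true → V B y ≡ true
  neighbour-in-B {y} xy = closed B y x (trans (Graph.sym B y x) xy)

  neighbour-apart : E B x y ≡ true → x ≢ y
  neighbour-apart xy refl = true≢false (trans (≡-sym xy) (Graph.irrefl B x))

  towardX : E B x y ≡ true → Rest y c → ∃ λ a → Walk B (del2 x y) c a × E B a x ≡ true
  towardX {c = c} xy (cB , kept) =
    let (c≢x , c≢y) = del2-keeps⁻ {u = x} {w = c} kept
    in block-approach blk cB xB c≢x c≢y (neighbour-apart xy)

  towardY : E B x y ≡ true → Rest y c → ∃ λ a → Walk B (del2 x y) c a × E B a y ≡ true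
  towardY {y} {c} xy (cB , kept) =
    let (c≢x , c≢y)    = del2-keeps⁻ {u = x} {w = c} kept
        (a , c→a , ay) = block-approach blk cB (neighbour-in-B xy) c≢y c≢x (≢-sym (neighbour-apart xy))
    in a , weaken (λ u → del2-swap {u = y} {v = x} {w = u}) c→a , ay

  -- If c does not reach d in B - {x,y}, then d leads to a neighbour y′ of x
  -- such that the component of y in B - {x,y′} strictly contains the
  -- component of c in B - {x,y} (it contains that component and y).
  grow : ∀ {d} → E B x y ≡ true → Rest y c → Rest y d → ¬ Walk B (del2 x y) c d
       → ∃ λ y′ → E B x y′ ≡ true × Rest y′ y × size y c < size y′ y
  grow {y} {c} xy cR dR c↛d with towardX xy dR
  ... | y′ , d→y′ , y′x = y′ , trans (Graph.sym B x y′) y′x , (yB , y-kept) , bigger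
    where
    yB : V B y ≡ true
    yB = neighbour-in-B xy
    y≢y′ : y ≢ y′
    y≢y′ refl = true≢false (trans (≡-sym (del2-deletes x y)) (proj₂ (finish d→y′)))
    y-kept : del2 x y′ y ≡ false
    y-kept = del2-keeps (≢-sym (neighbour-apart xy)) y≢y′
    -- walks from c in B - {x,y} never meet y′, so they are walks of B - {x,y′}
    shift : ∀ {w} → Walk B (del2 x y) c w → Walk B (del2 x y′) c w
    shift = confine λ u c→u →
      del2-keeps (proj₁ (del2-keeps⁻ {u = x} {w = u} (proj₂ (finish c→u))))
                 (λ { refl → c↛d (c→u ++ reverse d→y′) })
    y→c : Walk B (del2 x y′) y c
    y→c = let (a , c→a , ay) = towardY xy cR in reverse (snoc (shift c→a) ay y-kept)
    inclusion : component (del2 x y) c ⊆ᵇ component (del2 x y′) y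
    inclusion w cw = component-complete (y→c ++ shift (component-sound cw))
    bigger : size y c < size y′ y
    bigger = count-strict {f = component (del2 x y) c} {g = component (del2 x y′) y} inclusion
               (component-deleted (del2-deletes x y)) (component-complete (nil yB y-kept))

  step : E B x y ≡ true → Rest y c
       → Good y ⊎ ∃ λ y′ → E B x y′ ≡ true × Rest y′ y × size y c < size y′ y
  step {y} {c} xy cR with any? (λ d → rest? y d ×-dec ¬? (reach? (del2 x y) c d))
  ... | yes (d , dR , c↛d) = inj₂ (grow xy cR dR c↛d)
  ... | no none = inj₁ λ aR bR → reverse (fromC aR) ++ fromC bR
    where
    fromC : ∀ {a} → Rest y a → Walk B (del2 x y) c a
    fromC {a} aR with reach? (del2 x y) c a
    ... | yes c→a = c→a
    ... | no c↛a  = ⊥-elim (none (a , aR , c↛a))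

  -- iterate step; sizes are bounded by n, so k = n - size y c rounds suffice
  descend : ∀ k → E B x y ≡ true → Rest y c → n ≤ size y c + k
          → ∃ λ y → E B x y ≡ true × Good y
  descend zero xy cR n≤ = ⊥-elim (<⇒≱ size<n (≤-trans n≤ (≤-reflexive (+-identityʳ _))))
  descend {y} {c} (suc k) xy cR n≤ with step xy cR
  ... | inj₁ good = y , xy , good
  ... | inj₂ (y′ , xy′ , yR , bigger) =
        descend k xy′ yR (≤-trans n≤ (≤-trans (≤-reflexive (+-suc (size y c) k)) (+-monoˡ-≤ k bigger)))

  goodNeighbour : (∃ λ y → E B x y ≡ true) → ∃ λ y → E B x y ≡ true × Good y
  goodNeighbour (y , xy) with any? (rest? y)
  ... | yes (c , cR) = descend n xy cR (m≤n+m n (size y c))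
  ... | no empty     = y , xy , λ aR _ → ⊥-elim (empty (_ , aR))

  bridgeThrough : E B x y ≡ true → Rest y c → BridgeHasBoth B x y c
  bridgeThrough xy cR@(cB , kept) = cB , kept , towardX xy cR , towardY xy cR

module InGraph {n} {G B : Graph n} (blockOf : BlockOf B G) {x : Fin n} (xB : V B x ≡ true) where

  B⊑G : B ⊑ G
  B⊑G = proj₁ blockOf

  blk : IsBlock B
  blk = proj₁ (proj₂ blockOf)

  maximal : ∀ H → B ⊑ H → H ⊑ G → IsBlock H → H ⊑ B
  maximal = proj₂ (proj₂ blockOf)

  absorb : ∀ P → IsBlock (B ∪ induced G P) → (B ∪ induced G P) ⊑ B
  absorb P = maximal (B ∪ induced G P) (⊑-∪ˡ B (induced G P))
                     (∪-least {H₁ = B} {H₂ = induced G P} {G = G} B⊑G (induced⊑ G P))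

  open AroundVertex blk xB public
  open Walks G using (_++_; reverse; finish; confine; toPath; reach?)

  -- a non-isolated x has a neighbour in B: otherwise B is just x, and adding
  -- an edge xz of G gives a larger block
  neighbourInBlock : (∃ λ z → E G x z ≡ true) → ∃ λ y → E B x y ≡ true
  neighbourInBlock (z , xz) with any? (λ y → E B x y ≟ᵇ true)
  ... | yes found   = found
  ... | no isolated = ⊥-elim (isolated (z , proj₂ (absorb pair (edge-block two xz-H)) x z xz-H))
    where
    pair : Fin n → Bool
    pair u = ⌊ u ≟ x ⌋ ∨ ⌊ u ≟ z ⌋
    H : Graph n
    H = B ∪ induced G pair
    -- B is connected and x has no neighbour in B
    onlyX : ∀ {u} → V B u ≡ true → u ≡ x
    onlyX uB with proj₂ (proj₁ blk) x _ xB uB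
    ... | nil _ _      = refl
    ... | cons _ _ e _ = ⊥-elim (isolated (_ , e))
    two : ∀ u → V H u ≡ true → u ≡ x ⊎ u ≡ z
    two u uH with ∨-true (V B u) uH
    ... | inj₁ uB = inj₁ (onlyX uB)
    ... | inj₂ uK with ∨-true ⌊ u ≟ x ⌋ (proj₂ (∧-true (V G u) uK))
    ...   | inj₁ u=x = inj₁ (≟-sound u=x)
    ...   | inj₂ u=z = inj₂ (≟-sound u=z)
    xz-H : E H x z ≡ true
    xz-H = ∨-introʳ (E B x z) (induced-edge G pair xz (∨-introˡ ⌊ x ≟ z ⌋ (≟-refl x))
                                                   (∨-introʳ ⌊ z ≟ x ⌋ (≟-refl z)))

  -- every {x,y}-bridge of G containing x and y meets B - {x,y}: otherwise it
  -- contains a path outside B from a neighbour of x to a neighbour of y, an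
  -- ear whose addition to B would give a larger block
  bridgeMeetsBlock : ∀ {y z} → E B x y ≡ true → BridgeHasBoth G x y z
                   → ∃ λ b → Rest y b × Walk G (del2 x y) z b
  bridgeMeetsBlock {y} {z} xy (_ , _ , (a₁ , z→a₁ , a₁x) , (a₂ , z→a₂ , a₂y))
    with any? (λ b → rest? y b ×-dec reach? (del2 x y) z b)
  ... | yes found = found
  ... | no misses = ⊥-elim (extends (absorb span isBlock))
    where
    outside : ∀ u → Walk G (del2 x y) a₁ u → V B u ≡ false
    outside u a₁→u with V B u in uB
    ... | true  = ⊥-elim (misses (u , (uB , proj₂ (finish a₁→u)) , z→a₁ ++ a₁→u))
    ... | false = refl
    ear : Σ (Walk G (V B) a₁ a₂) (Walks.IsPath G)
    ear = toPath (confine outside (reverse z→a₁ ++ z→a₂))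
    open Ear blk xB (neighbour-in-B xy) (neighbour-apart xy) (proj₁ ear) (proj₂ ear) a₁x a₂y

lift-bridge : ∀ {n} {H₁ H₂ : Graph n} {u v w} → H₁ ⊑ H₂ → BridgeHasBoth H₁ u v w → BridgeHasBoth H₂ u v w
lift-bridge H₁⊑H₂ (wH , kept , (a , w→a , au) , (b , w→b , bv)) =
  proj₁ H₁⊑H₂ _ wH , kept , (a , lift H₁⊑H₂ w→a , proj₂ H₁⊑H₂ _ _ au) , (b , lift H₁⊑H₂ w→b , proj₂ H₁⊑H₂ _ _ bv)

CEq-none : ∀ {n} {H : Graph n} {u v} → (∀ z → ¬ BridgeHasBoth H u v z) → CEq H u v 0
CEq-none none = [] , refl , (λ _ ()) , (λ _ _ ()) , λ z bz → ⊥-elim (none z bz)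

CEq-single : ∀ {n} {H : Graph n} {u v c} → BridgeHasBoth H u v c
           → (∀ z → BridgeHasBoth H u v z → Walk H (del2 u v) z c) → CEq H u v 1
CEq-single {c = c} bc same =
  c ∷ [] , refl , (λ { _ (here refl) → bc }) , (λ { _ _ (here refl) (here refl) _ → refl })
  , λ z bz → c , here refl , same z bz

lemma3p3 : ∀ {n} (G B : Graph n) (x : Fin n)
    → V G x ≡ true → (∃ λ z → E G x z ≡ true)
    → BlockOf B G → V B x ≡ true
    → ∃ λ y → E B x y ≡ true × ∃ λ k → CEq B x y k × CEq G x y k × k ≤ 1
lemma3p3 G B x _ nonIsolated blockOf xB = result (goodNeighbour (neighbourInBlock nonIsolated))
  where
  open InGraph blockOf xB
  open Walks G using (_++_)

  result : (∃ λ y → E B x y ≡ true × Good y)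
         → ∃ λ y → E B x y ≡ true × ∃ λ k → CEq B x y k × CEq G x y k × k ≤ 1
  result (y , xy , good) with any? (rest? y)
  -- B = {x,y}: no bridge of B, and hence none of G, contains x and y
  ... | no empty = y , xy , 0
      , CEq-none (λ z bz → empty (z , proj₁ bz , proj₁ (proj₂ bz)))
      , CEq-none (λ z bz → empty (proj₁ (bridgeMeetsBlock xy bz) , proj₁ (proj₂ (bridgeMeetsBlock xy bz))))
      , z≤n
  -- otherwise the bridge through any c ∈ B - {x,y} is the only one, in B and in G
  ... | yes (c , cR) = y , xy , 1
      , CEq-single (bridgeThrough xy cR) (λ z bz → good (proj₁ bz , proj₁ (proj₂ bz)) cR)
      , CEq-single (lift-bridge B⊑G (bridgeThrough xy cR))
                   (λ z bz → let (b , bR , z→b) = bridgeMeetsBlock xy bz in z→b ++ lift B⊑G (good bR cR))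
      , s≤s z≤n
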